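{- Let $p\geq2$ be an integer. For all $\boldsymbol{r}\in\mathbb{Z}^2$, $$\operatorname{coeff}_{[\zeta_1^{r_1},\zeta_2^{r_2}]}F(\zeta_1,\zeta_2;q)=\mathbb{G}_{\boldsymbol{r}}(\tau).$$
   Context: For $\tau\in\mathbb{H}$, $q=e^{2\pi i\tau}$, $q^\alpha=e^{2\pi i\alpha\tau}$ for rational $\alpha$. $Q(\boldsymbol{n})=n_1^2+n_2^2-n_1n_2$, $\mathbb{N}=\{1,2,\dots\}$. For an integer $p\geq2$, \begin{multline*}F(\zeta_1,\zeta_2;q):=\sum_{\boldsymbol{n}\in\mathbb{Z}^2}\frac{q^{pQ(n_1-\frac1p,n_2-\frac1p)}}{(1-\zeta_1^{ -1})(1-\zeta_2^{ -1})(1-\zeta_1^{ -1}\zeta_2^{ -1})}\Big(\zeta_1^{n_1-1}\zeta_2^{n_2-1}-\zeta_1^{ -n_1+n_2-1}\zeta_2^{n_2-1}-\zeta_1^{n_1-1}\zeta_2^{ -n_2+n_1-1}\\+\zeta_1^{ -n_2-1}\zeta_2^{ -n_2+n_1-1}+\zeta_1^{ -n_1+n_2-1}\zeta_2^{ -n_1-1}-\zeta_1^{ -n_2-1}\zeta_2^{ -n_1-1}\Big);\end{multline*} each summand's rational function is a Laurent polynomial in $\zeta_1,\zeta_2$, so $F=\sum_{\boldsymbol{r}}c_{\boldsymbol{r}}(q)\zeta_1^{r_1}\zeta_2^{r_2}$ and $\operatorname{coeff}_{[\zeta_1^{r_1},\zeta_2^{r_2}]}F:=c_{\boldsymbol{r}}(q)$.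 For $\boldsymbol{\lambda}\in\mathbb{Q}^2$, \begin{multline*}\mathbb{G}_{\boldsymbol{\lambda}}(\tau):=\sum_{\boldsymbol{n}\in\mathbb{N}^2}\min(n_1,n_2)\,q^{pQ(\boldsymbol{n}+\boldsymbol{\lambda}-(\frac1p,\frac1p))}\Big(1-q^{2(n_1+\lambda_1)-(n_2+\lambda_2)}-q^{2(n_2+\lambda_2)-(n_1+\lambda_1)}\\+q^{3(n_1+\lambda_1)}+q^{3(n_2+\lambda_2)}-q^{2(n_1+\lambda_1)+2(n_2+\lambda_2)}\Big).\end{multline*} -}

module Defs where

open import Data.Nat as ℕ using (ℕ; zero; suc; NonZero)
open import Data.Integer as ℤ using (ℤ; +_; -_)
open import Data.Rational as ℚ using (ℚ)
open import Data.Rational.Properties using (_≟_)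
open import Data.List using (List; []; _∷_; _++_; map; concatMap; upTo; foldr)
open import Data.Product using (_×_; _,_)
open import Relation.Nullary using (yes; no)

-- Finite q-series with rational exponents: a finite list of terms
-- (exponent , coefficient), meaning  Σ coefficient · q^exponent.
-- coeffAt e s  is the coefficient of q^e in s.

QTerms : Set
QTerms = List (ℚ × ℤ)

coeffAt : ℚ → QTerms → ℤ
coeffAt e [] = + 0
coeffAt e ((x , c) ∷ s) with x ≟ e
... | yes _ = c ℤ.+ coeffAt e s
... | no  _ = coeffAt e s

⟦_⟧ : ℤ → ℚ
⟦ z ⟧ = z ℚ./ 1

Qf : ℚ → ℚ → ℚ
Qf x y = x ℚ.* x ℚ.+ y ℚ.* y ℚ.- x ℚ.* y

symRange : ℕ → List ℤ
symRange N = map (λ i → + i ℤ.- + N) (upTo (suc (N ℕ.+ N)))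

posRange : ℕ → List ℤ
posRange N = map (λ i → + suc i) (upTo N)

-- The denominator (1-ζ₁⁻¹)(1-ζ₂⁻¹)(1-ζ₁⁻¹ζ₂⁻¹) is inverted as a formal
-- power series in ζ₁⁻¹, ζ₂⁻¹:
--   1/denominator = Σ_{a,b,c ≥ 0} ζ₁^{-(a+c)} ζ₂^{-(b+c)} = Σ_{d} invDen d ζ₁^{-d₁} ζ₂^{-d₂},
-- where invDen (d₁,d₂) = #{(a,b,c) ∈ ℕ³ : a+c = d₁, b+c = d₂}
--                      = (min d₁ d₂ + 1) if d₁,d₂ ≥ 0, and 0 otherwise.
-- Since each summand's quotient is a Laurent polynomial P with
-- P · denominator = numerator, this expansion computes exactly the
-- coefficients of P.

invDen : ℤ → ℤ → ℤ
invDen d₁ d₂ with + 0 ℤ.≤? d₁ | + 0 ℤ.≤? d₂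
... | yes _ | yes _ = + suc (ℤ.∣ d₁ ∣ ℕ.⊓ ℤ.∣ d₂ ∣)
... | _     | _     = + 0

-- the six signed monomials ζ₁^{s₁} ζ₂^{s₂} of the numerator of the n-th summand
numerator : ℤ → ℤ → List (ℤ × (ℤ × ℤ))
numerator n₁ n₂ =
    (+ 1     , (n₁ ℤ.- + 1             , n₂ ℤ.- + 1))
  ∷ (ℤ.- + 1 , (ℤ.- n₁ ℤ.+ n₂ ℤ.- + 1 , n₂ ℤ.- + 1))
  ∷ (ℤ.- + 1 , (n₁ ℤ.- + 1             , ℤ.- n₂ ℤ.+ n₁ ℤ.- + 1))
  ∷ (+ 1     , (ℤ.- n₂ ℤ.- + 1         , ℤ.- n₂ ℤ.+ n₁ ℤ.- + 1))
  ∷ (+ 1     , (ℤ.- n₁ ℤ.+ n₂ ℤ.- + 1 , ℤ.- n₁ ℤ.- + 1))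
  ∷ (ℤ.- + 1 , (ℤ.- n₂ ℤ.- + 1         , ℤ.- n₁ ℤ.- + 1))
  ∷ []

summandCoeff : ℤ → ℤ → ℤ → ℤ → ℤ
summandCoeff r₁ r₂ n₁ n₂ =
  foldr ℤ._+_ (+ 0) (map (λ { (ε , (s₁ , s₂)) → ε ℤ.* invDen (s₁ ℤ.- r₁) (s₂ ℤ.- r₂) }) (numerator n₁ n₂))

-- the truncation of coeff_{[ζ₁^{r₁},ζ₂^{r₂}]} F to n ∈ [-N,N]²
Fbox : (p : ℕ) → .{{NonZero p}} → ℤ → ℤ → ℕ → QTerms
Fbox p r₁ r₂ N =
  concatMap (λ n₁ → map (λ n₂ →
      ( ⟦ + p ⟧ ℚ.* Qf (⟦ n₁ ⟧ ℚ.- (+ 1 ℚ./ p)) (⟦ n₂ ⟧ ℚ.- (+ 1 ℚ./ p))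
      , summandCoeff r₁ r₂ n₁ n₂ ))
    (symRange N))
  (symRange N)

-- The truncation of 𝔾_λ to n ∈ [1,N]²  (λ = (λ₁,λ₂) ∈ ℚ²)

Gbox : (p : ℕ) → .{{NonZero p}} → ℚ → ℚ → ℕ → QTerms
Gbox p λ₁ λ₂ N =
  concatMap (λ n₁ → concatMap (λ n₂ → terms n₁ n₂) (posRange N)) (posRange N)
  where
  terms : ℤ → ℤ → QTerms
  terms n₁ n₂ =
      (base           , w)
    ∷ (base ℚ.+ (⟦ + 2 ⟧ ℚ.* x ℚ.- y)              , ℤ.- w)
    ∷ (base ℚ.+ (⟦ + 2 ⟧ ℚ.* y ℚ.- x)              , ℤ.- w)
    ∷ (base ℚ.+ ⟦ + 3 ⟧ ℚ.* x                     , w)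
    ∷ (base ℚ.+ ⟦ + 3 ⟧ ℚ.* y                     , w)
    ∷ (base ℚ.+ (⟦ + 2 ⟧ ℚ.* x ℚ.+ ⟦ + 2 ⟧ ℚ.* y) , ℤ.- w)
    ∷ []
    where
    x = ⟦ n₁ ⟧ ℚ.+ λ₁
    y = ⟦ n₂ ⟧ ℚ.+ λ₂
    w = n₁ ℤ.⊓ n₂
    base = ⟦ + p ⟧ ℚ.* Qf (x ℚ.- (+ 1 ℚ./ p)) (y ℚ.- (+ 1 ℚ./ p))

-- The truncated q-expansion coefficients of both sides are finite sums, over a box of lattice
-- points, of terms δ(exponent = e) · weight.  The numerator of the n-th summand of F is a signed
-- sum over the Weyl group W of A₂ of monomials ζ^(w n − (1,1)), and the ζ^r-coefficient of such a
-- monomial divided by the denominator is min(m₁, m₂) at m = w n − r if m ≥ (1,1), and 0 otherwise.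
-- Reindexing the w-part of F by this m turns it into a sum over m ∈ ℕ², with exponent
-- p Q(w⁻¹(m + r) − 1/p); since Q is W-invariant this is the matching exponent of 𝔾_r, namely
-- p Q(m + r − 1/p) plus a linear form.  For p ≥ 2 the exponent is a positive definite quadratic
-- minus a linear form, so the lattice points of a fixed exponent e lie in a box of radius
-- T = 1 + |e − 1/p|, and all sums are constant once N ≥ 2T + ‖r‖.
module Submission where

open import Defs
open import Data.Integer as ℤ using (ℤ; +_; -[1+_]; 0ℤ; 1ℤ; _+_; _-_; _*_; -_; _⊓_; ∣_∣; +≤+)
import Data.Integer.Properties as ℤP
open import Algebra.Properties.CommutativeSemigroup ℤP.+-commutativeSemigroup using (interchange)
open import Algebra.Properties.CommutativeSemigroup ℤP.*-commutativeSemigroup using (x∙yz≈y∙xz)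
open import Data.Integer.Tactic.RingSolver using (solve-∀)
open import Data.List using (List; []; _∷_; _++_; map; concatMap; cartesianProduct)
open import Data.List.Membership.Propositional using (_∈_; _∉_)
open import Data.List.Membership.Propositional.Properties
  using (∈-map⁺; ∈-map⁻; ∈-upTo⁺; ∈-cartesianProduct⁺; ∈-cartesianProduct⁻)
import Data.List.Relation.Unary.All as All
open import Data.List.Relation.Unary.All.Properties using (All¬⇒¬Any)
open import Data.List.Relation.Unary.Any using (here; there)
open import Data.List.Relation.Unary.Unique.Propositional using (Unique; _∷_)
open import Data.List.Relation.Unary.Unique.Propositional.Properties using (map⁺; upTo⁺; cartesianProduct⁺)
open import Data.Nat as ℕ using (ℕ; NonZero; _≤_; zero; suc; s≤s; z≤n)
open import Data.Nat.Coprimality using (1-coprimeTo) renaming (sym to coprime-sym)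
import Data.Nat.Properties as ℕP
open import Data.Product using (_×_; ∃-syntax; _,_; proj₁; proj₂)
import Data.Product as ×
import Data.Product.Properties as ×P
open import Data.Rational as ℚ using (ℚ)
import Data.Rational.Properties as ℚP
import Data.Rational.Solver as ℚS
open import Function using (_∘_; id)
open import Relation.Binary.Definitions using (DecidableEquality)
open import Relation.Binary.PropositionalEquality
open import Relation.Nullary using (yes; no; contradiction)

private
  variable
    A B : Set

∑ : (A → ℤ) → List A → ℤ
∑ f []       = 0ℤ
∑ f (x ∷ xs) = f x + ∑ f xs

∑-cong-∈ : {f g : A → ℤ} {xs : List A} → (∀ {x} → x ∈ xs → f x ≡ g x) → ∑ f xs ≡ ∑ g xs
∑-cong-∈ {xs = []}     eq = refl
∑-cong-∈ {xs = x ∷ xs} eq = cong₂ _+_ (eq (here refl)) (∑-cong-∈ (eq ∘ there))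

∑-cong : {f g : A → ℤ} → (∀ x → f x ≡ g x) → ∀ xs → ∑ f xs ≡ ∑ g xs
∑-cong eq xs = ∑-cong-∈ {xs = xs} λ {x} _ → eq x

∑-zero : ∀ xs → ∑ (λ (_ : A) → 0ℤ) xs ≡ 0ℤ
∑-zero []       = refl
∑-zero (x ∷ xs) = trans (ℤP.+-identityˡ _) (∑-zero xs)

∑-+ : ∀ (f g : A → ℤ) xs → ∑ (λ x → f x + g x) xs ≡ ∑ f xs + ∑ g xs
∑-+ f g []       = refl
∑-+ f g (x ∷ xs) = trans (cong (_+_ (f x + g x)) (∑-+ f g xs)) (interchange (f x) (g x) _ _)

∑-*ˡ : ∀ k (f : A → ℤ) xs → ∑ (λ x → k * f x) xs ≡ k * ∑ f xs
∑-*ˡ k f []       = sym (ℤP.*-zeroʳ k)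
∑-*ˡ k f (x ∷ xs) = trans (cong (_+_ (k * f x)) (∑-*ˡ k f xs)) (sym (ℤP.*-distribˡ-+ k (f x) _))

∑-*ʳ : ∀ k (f : A → ℤ) xs → ∑ (λ x → f x * k) xs ≡ ∑ f xs * k
∑-*ʳ k f xs = trans (∑-cong (λ x → ℤP.*-comm (f x) k) xs) (trans (∑-*ˡ k f xs) (ℤP.*-comm k _))

∑-++ : ∀ (f : A → ℤ) xs ys → ∑ f (xs ++ ys) ≡ ∑ f xs + ∑ f ys
∑-++ f []       ys = sym (ℤP.+-identityˡ _)
∑-++ f (x ∷ xs) ys = trans (cong (_+_ (f x)) (∑-++ f xs ys)) (sym (ℤP.+-assoc (f x) _ _))

∑-map : (f : B → ℤ) (g : A → B) (xs : List A) → ∑ f (map g xs) ≡ ∑ (f ∘ g) xs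
∑-map f g []       = refl
∑-map f g (x ∷ xs) = cong (_+_ (f (g x))) (∑-map f g xs)

∑-concatMap : (f : B → ℤ) (g : A → List B) (xs : List A) → ∑ f (concatMap g xs) ≡ ∑ (∑ f ∘ g) xs
∑-concatMap f g []       = refl
∑-concatMap f g (x ∷ xs) =
  trans (∑-++ f (g x) (concatMap g xs)) (cong (_+_ (∑ f (g x))) (∑-concatMap f g xs))

∑-comm : (f : A → B → ℤ) (xs : List A) (ys : List B) →
         ∑ (λ x → ∑ (f x) ys) xs ≡ ∑ (λ y → ∑ (λ x → f x y) xs) ys
∑-comm f []       ys = sym (∑-zero ys)
∑-comm f (x ∷ xs) ys = trans (cong (_+_ (∑ (f x) ys)) (∑-comm f xs ys)) (sym (∑-+ (f x) _ ys))

∑-comm-*ˡ : (k : B → ℤ) (f : B → A → ℤ) (xs : List A) (ys : List B) →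
            ∑ (λ x → ∑ (λ y → k y * f y x) ys) xs ≡ ∑ (λ y → k y * ∑ (f y) xs) ys
∑-comm-*ˡ k f xs ys = trans (∑-comm (λ x y → k y * f y x) xs ys) (∑-cong (λ y → ∑-*ˡ (k y) (f y) xs) ys)

∑-cartesianProduct : (f : A × B → ℤ) (xs : List A) (ys : List B) →
                     ∑ f (cartesianProduct xs ys) ≡ ∑ (λ x → ∑ (λ y → f (x , y)) ys) xs
∑-cartesianProduct f []       ys = refl
∑-cartesianProduct f (x ∷ xs) ys =
  trans (∑-++ f (map (x ,_) ys) _) (cong₂ _+_ (∑-map f (x ,_) ys) (∑-cartesianProduct f xs ys))

*≢0 : ∀ {a b} → a * b ≢ 0ℤ → a ≢ 0ℤ × b ≢ 0ℤ
*≢0 {a} {b} ne = (λ { refl → ne refl }) , (λ { refl → ne (ℤP.*-zeroʳ a) })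

*-identity-on-support : ∀ {k c} → (c ≢ 0ℤ → k ≡ 1ℤ) → k * c ≡ c
*-identity-on-support {k} {c} k≡1 with c ℤ.≟ 0ℤ
... | yes refl = ℤP.*-zeroʳ k
... | no  c≢0  = trans (cong (_* c) (k≡1 c≢0)) (ℤP.*-identityˡ c)

module _ (_≟_ : DecidableEquality A) where

  δ : A → A → ℤ
  δ x v with x ≟ v
  ... | yes _ = 1ℤ
  ... | no  _ = 0ℤ

  δ-≡ : ∀ {x v} → x ≡ v → δ x v ≡ 1ℤ
  δ-≡ {x} {v} x≡v with x ≟ v
  ... | yes _   = refl
  ... | no  x≢v = contradiction x≡v x≢v

  δ-≢ : ∀ {x v} → x ≢ v → δ x v ≡ 0ℤ
  δ-≢ {x} {v} x≢v with x ≟ v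
  ... | yes x≡v = contradiction x≡v x≢v
  ... | no  _   = refl

  δ≢0⇒≡ : ∀ {x v} → δ x v ≢ 0ℤ → x ≡ v
  δ≢0⇒≡ {x} {v} ne with x ≟ v
  ... | yes x≡v = x≡v
  ... | no  _   = contradiction refl ne

  multiplicity : List A → A → ℤ
  multiplicity xs v = ∑ (λ x → δ x v) xs

  multiplicity-∉ : ∀ {v xs} → v ∉ xs → multiplicity xs v ≡ 0ℤ
  multiplicity-∉ {xs = []}     _   = refl
  multiplicity-∉ {xs = x ∷ xs} v∉ =
    cong₂ _+_ (δ-≢ λ x≡v → v∉ (here (sym x≡v))) (multiplicity-∉ (v∉ ∘ there))

  multiplicity-unique : ∀ {v xs} → Unique xs → v ∈ xs → multiplicity xs v ≡ 1ℤ
  multiplicity-unique (x∉ ∷ _) (here refl) = cong₂ _+_ (δ-≡ refl) (multiplicity-∉ (All¬⇒¬Any x∉))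
  multiplicity-unique (x∉ ∷ u) (there v∈) = cong₂ _+_ (δ-≢ (All.lookup x∉ v∈)) (multiplicity-unique u v∈)

module _ (_≟ᴬ_ : DecidableEquality A) (_≟ᴮ_ : DecidableEquality B)
         (φ : A → B) (ψ : B → A) (ψ∘φ : ∀ x → ψ (φ x) ≡ x) (φ∘ψ : ∀ y → φ (ψ y) ≡ y) where

  ∑-reindex : ∀ {xs ys} → Unique xs → Unique ys → (h : A → ℤ) →
              (∀ x → h x ≢ 0ℤ → x ∈ xs × φ x ∈ ys) → ∑ h xs ≡ ∑ (h ∘ ψ) ys
  ∑-reindex {xs} {ys} !xs !ys h supp = begin
    ∑ h xs
      ≡⟨ ∑-cong (λ x → sym (*-identity-on-support λ hx≢0 →
           multiplicity-unique _≟ᴮ_ !ys (proj₂ (supp x hx≢0)))) xs ⟩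
    ∑ (λ x → multiplicity _≟ᴮ_ ys (φ x) * h x) xs
      ≡⟨ ∑-cong (λ x → sym (∑-*ʳ (h x) (λ y → δ _≟ᴮ_ y (φ x)) ys)) xs ⟩
    ∑ (λ x → ∑ (λ y → δ _≟ᴮ_ y (φ x) * h x) ys) xs
      ≡⟨ ∑-comm _ xs ys ⟩
    ∑ (λ y → ∑ (λ x → δ _≟ᴮ_ y (φ x) * h x) xs) ys
      ≡⟨ ∑-cong (λ y → ∑-cong (δ-transport y) xs) ys ⟩
    ∑ (λ y → ∑ (λ x → δ _≟ᴬ_ x (ψ y) * h (ψ y)) xs) ys
      ≡⟨ ∑-cong (λ y → ∑-*ʳ (h (ψ y)) (λ x → δ _≟ᴬ_ x (ψ y)) xs) ys ⟩
    ∑ (λ y → multiplicity _≟ᴬ_ xs (ψ y) * h (ψ y)) ys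
      ≡⟨ ∑-cong (λ y → *-identity-on-support λ hψy≢0 →
           multiplicity-unique _≟ᴬ_ !xs (proj₁ (supp (ψ y) hψy≢0))) ys ⟩
    ∑ (h ∘ ψ) ys ∎
    where
    open ≡-Reasoning
    δ-transport : ∀ y x → δ _≟ᴮ_ y (φ x) * h x ≡ δ _≟ᴬ_ x (ψ y) * h (ψ y)
    δ-transport y x with y ≟ᴮ φ x
    ... | yes refl rewrite ψ∘φ x | δ-≡ _≟ᴬ_ {x} refl = refl
    ... | no  y≢φx = sym (cong (_* h (ψ y))
                      (δ-≢ _≟ᴬ_ λ x≡ψy → y≢φx (trans (sym (φ∘ψ y)) (cong φ (sym x≡ψy)))))

i-j+j≡i : ∀ i j → i - j + j ≡ i
i-j+j≡i = solve-∀

i+j-j≡i : ∀ i j → i + j - j ≡ i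
i+j-j≡i = solve-∀

i≤+∣i∣ : ∀ i → i ℤ.≤ + ∣ i ∣
i≤+∣i∣ (+ n)    = ℤP.≤-refl
i≤+∣i∣ -[1+ n ] = ℤ.-≤+

0≤+ : ∀ {i j} → 0ℤ ℤ.≤ i → 0ℤ ℤ.≤ j → 0ℤ ℤ.≤ i + j
0≤+ = ℤP.+-mono-≤

0≤i*i : ∀ i → 0ℤ ℤ.≤ i * i
0≤i*i (+ n)    = subst (0ℤ ℤ.≤_) (ℤP.pos-* n n) (+≤+ z≤n)
0≤i*i -[1+ n ] = +≤+ z≤n

0≤i*i-i : ∀ i → 0ℤ ℤ.≤ i * i - i
0≤i*i-i (+ zero)  = +≤+ z≤n
0≤i*i-i (+ suc n) = ℤP.i≤j⇒0≤j-i (+≤+ (ℕP.m≤m*n (suc n) (suc n)))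
0≤i*i-i -[1+ n ]  = +≤+ z≤n

0≤Q : ∀ a b → 0ℤ ℤ.≤ a * a + b * b - a * b
0≤Q a b = ℤP.*-cancelˡ-≤-pos 0ℤ _ (+ 2)
  (subst (0ℤ ℤ.≤_) (two-Q a b) (0≤+ (0≤+ (0≤i*i a) (0≤i*i b)) (0≤i*i (a - b))))
  where
  two-Q : ∀ a b → a * a + b * b + (a - b) * (a - b) ≡ + 2 * (a * a + b * b - a * b)
  two-Q = solve-∀

⟦⟧≡mkℚ : ∀ z → ⟦ z ⟧ ≡ ℚ.mkℚ z 0 (coprime-sym (1-coprimeTo ∣ z ∣))
⟦⟧≡mkℚ z = ℚP.↥p/↧p≡p (ℚ.mkℚ z 0 (coprime-sym (1-coprimeTo ∣ z ∣)))

↥⟦⟧ : ∀ z → ℚ.↥ ⟦ z ⟧ ≡ z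
↥⟦⟧ z = cong ℚ.↥_ (⟦⟧≡mkℚ z)

⟦⟧-homo-+ : ∀ a b → ⟦ a + b ⟧ ≡ ⟦ a ⟧ ℚ.+ ⟦ b ⟧
⟦⟧-homo-+ a b rewrite ⟦⟧≡mkℚ a | ⟦⟧≡mkℚ b = cong (ℚ._/ 1) (a+b≡a*1+b*1 a b)
  where
  a+b≡a*1+b*1 : ∀ a b → a + b ≡ a * 1ℤ + b * 1ℤ
  a+b≡a*1+b*1 = solve-∀

⟦⟧-homo-* : ∀ a b → ⟦ a * b ⟧ ≡ ⟦ a ⟧ ℚ.* ⟦ b ⟧
⟦⟧-homo-* a b rewrite ⟦⟧≡mkℚ a | ⟦⟧≡mkℚ b = refl

⟦⟧-homo‿- : ∀ a → ⟦ - a ⟧ ≡ ℚ.- ⟦ a ⟧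
⟦⟧-homo‿- a = trans (⟦⟧≡mkℚ (- a)) (trans (neg-mkℚ a) (cong ℚ.-_ (sym (⟦⟧≡mkℚ a))))
  where
  neg-mkℚ : ∀ a → ℚ.mkℚ (- a) 0 (coprime-sym (1-coprimeTo ∣ - a ∣))
                  ≡ ℚ.- ℚ.mkℚ a 0 (coprime-sym (1-coprimeTo ∣ a ∣))
  neg-mkℚ (+ zero)  = refl
  neg-mkℚ (+ suc n) = refl
  neg-mkℚ -[1+ n ]  = refl

⟦⟧-homo-- : ∀ a b → ⟦ a - b ⟧ ≡ ⟦ a ⟧ ℚ.- ⟦ b ⟧
⟦⟧-homo-- a b = trans (⟦⟧-homo-+ a (- b)) (cong (⟦ a ⟧ ℚ.+_) (⟦⟧-homo‿- b))

⟦_⟧² : ℤ × ℤ → ℚ × ℚ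
⟦_⟧² = ×.map ⟦_⟧ ⟦_⟧

_≟²_ : DecidableEquality (ℤ × ℤ)
_≟²_ = ×P.≡-dec ℤ._≟_ ℤ._≟_

‖_‖ : ℤ × ℤ → ℕ
‖ a , b ‖ = ∣ a ∣ ℕ.⊔ ∣ b ∣

_⊞_ : ℤ × ℤ → ℤ × ℤ → ℤ × ℤ
(a , b) ⊞ (c , d) = a + c , b + d

_⊟_ : ℤ × ℤ → ℤ × ℤ → ℤ × ℤ
(a , b) ⊟ (c , d) = a - c , b - d

⊟-⊞-cancel : ∀ u r → (u ⊟ r) ⊞ r ≡ u
⊟-⊞-cancel (a , b) (c , d) = cong₂ _,_ (i-j+j≡i a c) (i-j+j≡i b d)

⊞-⊟-cancel : ∀ u r → (u ⊞ r) ⊟ r ≡ u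
⊞-⊟-cancel (a , b) (c , d) = cong₂ _,_ (i+j-j≡i a c) (i+j-j≡i b d)

‖⊟‖≤ : ∀ u r → ‖ u ⊟ r ‖ ≤ ‖ u ‖ ℕ.+ ‖ r ‖
‖⊟‖≤ (a , b) (c , d) = ℕP.⊔-lub
  (ℕP.≤-trans (ℤP.∣i-j∣≤∣i∣+∣j∣ a c) (ℕP.+-mono-≤ (ℕP.m≤m⊔n ∣ a ∣ ∣ b ∣) (ℕP.m≤m⊔n ∣ c ∣ ∣ d ∣)))
  (ℕP.≤-trans (ℤP.∣i-j∣≤∣i∣+∣j∣ b d) (ℕP.+-mono-≤ (ℕP.m≤n⊔m ∣ a ∣ ∣ b ∣) (ℕP.m≤n⊔m ∣ c ∣ ∣ d ∣)))

square : List A → List (A × A)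
square xs = cartesianProduct xs xs

square-unique : ∀ {xs : List A} → Unique xs → Unique (square xs)
square-unique !xs = cartesianProduct⁺ !xs !xs

symRange-unique : ∀ N → Unique (symRange N)
symRange-unique N = map⁺ (λ eq → ℤP.+-injective (trans (sym (i-j+j≡i _ (+ N)))
                                  (trans (cong (λ z → z + + N) eq) (i-j+j≡i _ (+ N))))) (upTo⁺ _)

∈-symRange : ∀ {N v} → ∣ v ∣ ≤ N → v ∈ symRange N
∈-symRange {N} {v} ∣v∣≤N = subst (_∈ symRange N) shift-back (∈-map⁺ (λ i → + i - + N) (∈-upTo⁺ index<))
  where
  0≤v+N : ∀ {v} → ∣ v ∣ ≤ N → 0ℤ ℤ.≤ v + + N
  0≤v+N {+ n}      _   = +≤+ z≤n
  0≤v+N { -[1+ n ]} n<N = subst (0ℤ ℤ.≤_) (sym (ℤP.⊖-≥ n<N)) (+≤+ z≤n)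
  shift-back : + ∣ v + + N ∣ - + N ≡ v
  shift-back = trans (cong (_- + N) (ℤP.0≤i⇒+∣i∣≡i (0≤v+N {v} ∣v∣≤N))) (i+j-j≡i v (+ N))
  index< : ∣ v + + N ∣ ℕ.< suc (N ℕ.+ N)
  index< = s≤s (ℕP.≤-trans (ℤP.∣i+j∣≤∣i∣+∣j∣ v (+ N)) (ℕP.+-monoˡ-≤ N ∣v∣≤N))

∈-square-symRange : ∀ {N n} → ‖ n ‖ ≤ N → n ∈ square (symRange N)
∈-square-symRange {n = a , b} ‖n‖≤N =
  ∈-cartesianProduct⁺ (∈-symRange (ℕP.m⊔n≤o⇒m≤o _ _ ‖n‖≤N)) (∈-symRange (ℕP.m⊔n≤o⇒n≤o _ _ ‖n‖≤N))

posRange-unique : ∀ N → Unique (posRange N)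
posRange-unique N = map⁺ (λ { refl → refl }) (upTo⁺ N)

∈-posRange : ∀ {N m} → 1ℤ ℤ.≤ m → ∣ m ∣ ≤ N → m ∈ posRange N
∈-posRange {m = + suc i} (+≤+ (s≤s z≤n)) m≤N = ∈-map⁺ (λ i → + suc i) (∈-upTo⁺ m≤N)

∈-posRange⁻ : ∀ {N m} → m ∈ posRange N → 1ℤ ℤ.≤ m
∈-posRange⁻ m∈ with _ , _ , refl ← ∈-map⁻ (λ i → + suc i) m∈ = +≤+ (s≤s z≤n)

-- The Weyl group of A₂

-- Elements are written as words in the simple reflections s₁, s₂; the numerator of the n-th
-- summand of F is ∑ over w of sign w · ζ^(act w n − (1,1)), in the order of elements.
data W : Set where
  ι s₁ s₂ s₁s₂ s₂s₁ w₀ : W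

elements : List W
elements = ι ∷ s₁ ∷ s₂ ∷ s₁s₂ ∷ s₂s₁ ∷ w₀ ∷ []

_⁻¹ : W → W
s₁s₂ ⁻¹ = s₂s₁
s₂s₁ ⁻¹ = s₁s₂
w    ⁻¹ = w

⁻¹-involutive : ∀ w → w ⁻¹ ⁻¹ ≡ w
⁻¹-involutive ι    = refl
⁻¹-involutive s₁   = refl
⁻¹-involutive s₂   = refl
⁻¹-involutive s₁s₂ = refl
⁻¹-involutive s₂s₁ = refl
⁻¹-involutive w₀   = refl

sign : W → ℤ
sign ι    = 1ℤ
sign s₁   = - 1ℤ
sign s₂   = - 1ℤ
sign s₁s₂ = 1ℤ
sign s₂s₁ = 1ℤ
sign w₀   = - 1ℤ

signed : W → ℤ → ℤ
signed ι    k = k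
signed s₁   k = - k
signed s₂   k = - k
signed s₁s₂ k = k
signed s₂s₁ k = k
signed w₀   k = - k

signed≡sign* : ∀ w k → signed w k ≡ sign w * k
signed≡sign* ι    k = sym (ℤP.*-identityˡ k)
signed≡sign* s₁   k = sym (ℤP.-1*i≡-i k)
signed≡sign* s₂   k = sym (ℤP.-1*i≡-i k)
signed≡sign* s₁s₂ k = sym (ℤP.*-identityˡ k)
signed≡sign* s₂s₁ k = sym (ℤP.*-identityˡ k)
signed≡sign* w₀   k = sym (ℤP.-1*i≡-i k)

module Action {R : Set} (_⊕_ : R → R → R) (⊖_ : R → R) where

  act : W → R × R → R × R
  act ι    (x , y) = x , y
  act s₁   (x , y) = (⊖ x) ⊕ y , y
  act s₂   (x , y) = x , (⊖ y) ⊕ x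
  act s₁s₂ (x , y) = ⊖ y , (⊖ y) ⊕ x
  act s₂s₁ (x , y) = (⊖ x) ⊕ y , ⊖ x
  act w₀   (x , y) = ⊖ y , ⊖ x

module ℤ² = Action _+_ -_
module ℚ² = Action ℚ._+_ ℚ.-_

act-natural : (f : ℤ → ℚ) → (∀ a b → f (a + b) ≡ f a ℚ.+ f b) → (∀ a → f (- a) ≡ ℚ.- f a) →
              ∀ w n → ×.map f f (ℤ².act w n) ≡ ℚ².act w (×.map f f n)
act-natural f f-+ f-neg = λ where
    ι    (x , y) → refl
    s₁   (x , y) → cong (_, f y) (f-lin x y)
    s₂   (x , y) → cong (f x ,_) (f-lin y x)
    s₁s₂ (x , y) → cong₂ _,_ (f-neg y) (f-lin y x)
    s₂s₁ (x , y) → cong₂ _,_ (f-lin x y) (f-neg x)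
    w₀   (x , y) → cong₂ _,_ (f-neg y) (f-neg x)
  where
  f-lin : ∀ a b → f (- a + b) ≡ ℚ.- f a ℚ.+ f b
  f-lin a b = trans (f-+ (- a) b) (cong (ℚ._+ f b) (f-neg a))

act-inverse : ∀ w n → ℤ².act (w ⁻¹) (ℤ².act w n) ≡ n
act-inverse = λ where
    ι    (x , y) → refl
    s₁   (x , y) → cong (_, y) (cancel₁ x y)
    s₂   (x , y) → cong (x ,_) (cancel₁ y x)
    s₁s₂ (x , y) → cong₂ _,_ (cancel₂ y x) (ℤP.neg-involutive y)
    s₂s₁ (x , y) → cong₂ _,_ (ℤP.neg-involutive x) (cancel₂ x y)
    w₀   (x , y) → cong₂ _,_ (ℤP.neg-involutive x) (ℤP.neg-involutive y)
  where
  cancel₁ : ∀ a b → - (- a + b) + b ≡ a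
  cancel₁ = solve-∀
  cancel₂ : ∀ a b → - (- a) + (- a + b) ≡ b
  cancel₂ = solve-∀

act-inverseʳ : ∀ w n → ℤ².act w (ℤ².act (w ⁻¹) n) ≡ n
act-inverseʳ w n = subst (λ v → ℤ².act v (ℤ².act (w ⁻¹) n) ≡ n) (⁻¹-involutive w) (act-inverse (w ⁻¹) n)

act-bound : ∀ w n → ‖ ℤ².act w n ‖ ≤ ‖ n ‖ ℕ.+ ‖ n ‖
act-bound w (x , y) = bound w
  where
  M = ∣ x ∣ ℕ.⊔ ∣ y ∣
  x≤ : ∣ x ∣ ≤ M
  x≤ = ℕP.m≤m⊔n ∣ x ∣ ∣ y ∣
  y≤ : ∣ y ∣ ≤ M
  y≤ = ℕP.m≤n⊔m ∣ x ∣ ∣ y ∣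
  -≤ : ∀ a → ∣ a ∣ ≤ M → ∣ - a ∣ ≤ M
  -≤ a = subst (_≤ M) (sym (ℤP.∣-i∣≡∣i∣ a))
  double : ∀ a → ∣ a ∣ ≤ M → ∣ a ∣ ≤ M ℕ.+ M
  double a = ℕP.m≤n⇒m≤n+o M
  -+≤ : ∀ a b → ∣ a ∣ ≤ M → ∣ b ∣ ≤ M → ∣ - a + b ∣ ≤ M ℕ.+ M
  -+≤ a b a≤ b≤ = ℕP.≤-trans (ℤP.∣i+j∣≤∣i∣+∣j∣ (- a) b) (ℕP.+-mono-≤ (-≤ a a≤) b≤)
  bound : ∀ w → ‖ ℤ².act w (x , y) ‖ ≤ M ℕ.+ M
  bound ι    = ℕP.⊔-lub (double x x≤) (double y y≤)
  bound s₁   = ℕP.⊔-lub (-+≤ x y x≤ y≤) (double y y≤)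
  bound s₂   = ℕP.⊔-lub (double x x≤) (-+≤ y x y≤ x≤)
  bound s₁s₂ = ℕP.⊔-lub (double (- y) (-≤ y y≤)) (-+≤ y x y≤ x≤)
  bound s₂s₁ = ℕP.⊔-lub (-+≤ x y x≤ y≤) (double (- x) (-≤ x x≤))
  bound w₀   = ℕP.⊔-lub (double (- y) (-≤ y y≤)) (double (- x) (-≤ x x≤))

-- The ζ^r-coefficient of ζ^(u − (1,1)) / ((1−ζ₁⁻¹)(1−ζ₂⁻¹)(1−ζ₁⁻¹ζ₂⁻¹)) is weight (u ⊟ r).
weight : ℤ × ℤ → ℤ
weight (m₁ , m₂) = invDen (m₁ - 1ℤ) (m₂ - 1ℤ)

weight-positive : ∀ {m₁ m₂} → 1ℤ ℤ.≤ m₁ → 1ℤ ℤ.≤ m₂ → weight (m₁ , m₂) ≡ m₁ ⊓ m₂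
weight-positive (+≤+ (s≤s z≤n)) (+≤+ (s≤s z≤n)) = refl

weight-support : ∀ m → weight m ≢ 0ℤ → 1ℤ ℤ.≤ proj₁ m × 1ℤ ℤ.≤ proj₂ m
weight-support (m₁ , m₂) ne with 0ℤ ℤ.≤? m₁ - 1ℤ | 0ℤ ℤ.≤? m₂ - 1ℤ
... | yes 0≤m₁-1 | yes 0≤m₂-1 = ℤP.0≤i-j⇒j≤i 0≤m₁-1 , ℤP.0≤i-j⇒j≤i 0≤m₂-1
... | yes _      | no  _      = contradiction refl ne
... | no  _      | _          = contradiction refl ne

monomialCoeff : ℚ → ℚ × ℤ → ℤ
monomialCoeff e (x , k) = δ ℚP._≟_ x e * k

coeffAt≡∑ : ∀ e s → coeffAt e s ≡ ∑ (monomialCoeff e) s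
coeffAt≡∑ e []            = refl
coeffAt≡∑ e ((x , k) ∷ s) with x ℚP.≟ e
... | yes _ = cong₂ _+_ (sym (ℤP.*-identityˡ k)) (coeffAt≡∑ e s)
... | no  _ = trans (coeffAt≡∑ e s) (sym (ℤP.+-identityˡ _))

module Exponent (p : ℕ) .{{_ : NonZero p}} where

  c : ℚ
  c = + 1 ℚ./ p

  p*c≡1 : ⟦ + p ⟧ ℚ.* c ≡ ℚ.1ℚ
  p*c≡1 = n*1/n≡1 p
    where
    n*1/n≡1 : ∀ n .{{_ : NonZero n}} → ⟦ + n ⟧ ℚ.* (+ 1 ℚ./ n) ≡ ℚ.1ℚ
    n*1/n≡1 (suc k) = trans (cong₂ ℚ._*_ (⟦⟧≡mkℚ (+ suc k)) (ℚP.↥p/↧p≡p (ℚ.mkℚ (+ 1) k (1-coprimeTo _))))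
                            (ℚP.*-inverseʳ (ℚ.mkℚ (+ suc k) 0 (coprime-sym (1-coprimeTo (suc k)))))

  X : ℚ × ℚ → ℚ
  X (x , y) = ⟦ + p ⟧ ℚ.* Qf (x ℚ.- c) (y ℚ.- c)

  Qℤ : ℤ × ℤ → ℤ
  Qℤ (a , b) = a * a + b * b - a * b

  X₀ : ℤ × ℤ → ℤ
  X₀ (a , b) = + p * Qℤ (a , b) - a - b

  ⟦X₀⟧ : ∀ a b → ⟦ X₀ (a , b) ⟧ ≡ ⟦ + p ⟧ ℚ.* Qf ⟦ a ⟧ ⟦ b ⟧ ℚ.- ⟦ a ⟧ ℚ.- ⟦ b ⟧
  ⟦X₀⟧ a b = begin
    ⟦ + p * Qℤ (a , b) - a - b ⟧              ≡⟨ ⟦⟧-homo-- (+ p * Qℤ (a , b) - a) b ⟩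
    ⟦ + p * Qℤ (a , b) - a ⟧ ℚ.- ⟦ b ⟧         ≡⟨ cong (ℚ._- ⟦ b ⟧) (⟦⟧-homo-- (+ p * Qℤ (a , b)) a) ⟩
    ⟦ + p * Qℤ (a , b) ⟧ ℚ.- ⟦ a ⟧ ℚ.- ⟦ b ⟧
      ≡⟨ cong (λ z → z ℚ.- ⟦ a ⟧ ℚ.- ⟦ b ⟧) (⟦⟧-homo-* (+ p) (Qℤ (a , b))) ⟩
    ⟦ + p ⟧ ℚ.* ⟦ Qℤ (a , b) ⟧ ℚ.- ⟦ a ⟧ ℚ.- ⟦ b ⟧
      ≡⟨ cong (λ z → ⟦ + p ⟧ ℚ.* z ℚ.- ⟦ a ⟧ ℚ.- ⟦ b ⟧) ⟦Q⟧ ⟩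
    ⟦ + p ⟧ ℚ.* Qf ⟦ a ⟧ ⟦ b ⟧ ℚ.- ⟦ a ⟧ ℚ.- ⟦ b ⟧ ∎
    where
    open ≡-Reasoning
    ⟦Q⟧ : ⟦ Qℤ (a , b) ⟧ ≡ Qf ⟦ a ⟧ ⟦ b ⟧
    ⟦Q⟧ = trans (⟦⟧-homo-- (a * a + b * b) (a * b)) (cong₂ ℚ._-_
            (trans (⟦⟧-homo-+ (a * a) (b * b)) (cong₂ ℚ._+_ (⟦⟧-homo-* a a) (⟦⟧-homo-* b b))) (⟦⟧-homo-* a b))

  X-integral : ∀ n → X ⟦ n ⟧² ≡ ⟦ X₀ n ⟧ ℚ.+ c
  X-integral (a , b) = begin
    X (⟦ a ⟧ , ⟦ b ⟧)
      ≡⟨ expand ⟦ + p ⟧ c ⟦ a ⟧ ⟦ b ⟧ ⟩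
    ⟦ + p ⟧ ℚ.* Qf ⟦ a ⟧ ⟦ b ⟧ ℚ.- (⟦ + p ⟧ ℚ.* c) ℚ.* (⟦ a ⟧ ℚ.+ ⟦ b ⟧) ℚ.+ (⟦ + p ⟧ ℚ.* c) ℚ.* c
      ≡⟨ cong (λ u → ⟦ + p ⟧ ℚ.* Qf ⟦ a ⟧ ⟦ b ⟧ ℚ.- u ℚ.* (⟦ a ⟧ ℚ.+ ⟦ b ⟧) ℚ.+ u ℚ.* c) p*c≡1 ⟩
    ⟦ + p ⟧ ℚ.* Qf ⟦ a ⟧ ⟦ b ⟧ ℚ.- ℚ.1ℚ ℚ.* (⟦ a ⟧ ℚ.+ ⟦ b ⟧) ℚ.+ ℚ.1ℚ ℚ.* c
      ≡⟨ simplify (⟦ + p ⟧ ℚ.* Qf ⟦ a ⟧ ⟦ b ⟧) c ⟦ a ⟧ ⟦ b ⟧ ⟩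
    ⟦ + p ⟧ ℚ.* Qf ⟦ a ⟧ ⟦ b ⟧ ℚ.- ⟦ a ⟧ ℚ.- ⟦ b ⟧ ℚ.+ c
      ≡⟨ cong (ℚ._+ c) (⟦X₀⟧ a b) ⟨
    ⟦ X₀ (a , b) ⟧ ℚ.+ c ∎
    where
    open ≡-Reasoning
    open ℚS.+-*-Solver using (solve; _:=_; _:+_; _:*_; _:-_; con; Polynomial)
    Qₚ : ∀ {m} → Polynomial m → Polynomial m → Polynomial m
    Qₚ x y = x :* x :+ y :* y :- x :* y
    expand : ∀ P C x y → P ℚ.* Qf (x ℚ.- C) (y ℚ.- C)
                         ≡ P ℚ.* Qf x y ℚ.- (P ℚ.* C) ℚ.* (x ℚ.+ y) ℚ.+ (P ℚ.* C) ℚ.* C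
    expand = solve 4 (λ P C x y → P :* Qₚ (x :- C) (y :- C)
                                  := P :* Qₚ x y :- (P :* C) :* (x :+ y) :+ (P :* C) :* C) refl
    simplify : ∀ Z C x y → Z ℚ.- ℚ.1ℚ ℚ.* (x ℚ.+ y) ℚ.+ ℚ.1ℚ ℚ.* C ≡ Z ℚ.- x ℚ.- y ℚ.+ C
    simplify = solve 4 (λ Z C x y → Z :- con ℚ.1ℚ :* (x :+ y) :+ con ℚ.1ℚ :* C := Z :- x :- y :+ C) refl

  X≡⇒X₀≡ : ∀ {n e} → X ⟦ n ⟧² ≡ e → X₀ n ≡ ℚ.↥ (e ℚ.- c)
  X≡⇒X₀≡ {n} {e} eq = begin
    X₀ n                         ≡⟨ ↥⟦⟧ (X₀ n) ⟨
    ℚ.↥ ⟦ X₀ n ⟧                 ≡⟨ cong ℚ.↥_ (+-cancelʳ ⟦ X₀ n ⟧ c) ⟨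
    ℚ.↥ (⟦ X₀ n ⟧ ℚ.+ c ℚ.- c)   ≡⟨ cong (λ z → ℚ.↥ (z ℚ.- c)) (trans (sym (X-integral n)) eq) ⟩
    ℚ.↥ (e ℚ.- c) ∎
    where
    open ≡-Reasoning
    open ℚS.+-*-Solver using (solve; _:=_; _:+_; _:-_)
    +-cancelʳ : ∀ z c → z ℚ.+ c ℚ.- c ≡ z
    +-cancelʳ = solve 2 (λ z c → z :+ c :- c := z) refl

  𝔾-exponent : W → ℚ × ℚ → ℚ
  𝔾-exponent ι    v       = X v
  𝔾-exponent s₁   (x , y) = X (x , y) ℚ.+ (⟦ + 2 ⟧ ℚ.* x ℚ.- y)
  𝔾-exponent s₂   (x , y) = X (x , y) ℚ.+ (⟦ + 2 ⟧ ℚ.* y ℚ.- x)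
  𝔾-exponent s₁s₂ (x , y) = X (x , y) ℚ.+ ⟦ + 3 ⟧ ℚ.* x
  𝔾-exponent s₂s₁ (x , y) = X (x , y) ℚ.+ ⟦ + 3 ⟧ ℚ.* y
  𝔾-exponent w₀   (x , y) = X (x , y) ℚ.+ (⟦ + 2 ⟧ ℚ.* x ℚ.+ ⟦ + 2 ⟧ ℚ.* y)

  -- Q is W-invariant, so X (act w⁻¹ v) − X v = p·c·(σ v − σ (act w⁻¹ v)) with σ (x , y) = x + y,
  -- and p·c = 1.
  X-act : ∀ w v → X (ℚ².act (w ⁻¹) v) ≡ 𝔾-exponent w v
  X-act = λ where
      ι    (x , y) → refl
      s₁   (x , y) → use-p*c≡1 (X (x , y)) _ (shift-s₁ ⟦ + p ⟧ c x y)
      s₂   (x , y) → use-p*c≡1 (X (x , y)) _ (shift-s₂ ⟦ + p ⟧ c x y)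
      s₁s₂ (x , y) → use-p*c≡1 (X (x , y)) _ (shift-s₁s₂ ⟦ + p ⟧ c x y)
      s₂s₁ (x , y) → use-p*c≡1 (X (x , y)) _ (shift-s₂s₁ ⟦ + p ⟧ c x y)
      w₀   (x , y) → use-p*c≡1 (X (x , y)) _ (shift-w₀ ⟦ + p ⟧ c x y)
    where
    open ℚS.+-*-Solver using (solve; _:=_; _:+_; _:*_; _:-_; :-_; con; Polynomial)
    use-p*c≡1 : ∀ {a} b ℓ → a ≡ b ℚ.+ (⟦ + p ⟧ ℚ.* c) ℚ.* ℓ → a ≡ b ℚ.+ ℓ
    use-p*c≡1 b ℓ eq = trans eq (cong (b ℚ.+_) (trans (cong (ℚ._* ℓ) p*c≡1) (ℚP.*-identityˡ ℓ)))
    Xₚ : ∀ {m} → Polynomial m → Polynomial m → Polynomial m → Polynomial m → Polynomial m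
    Xₚ P C x y = P :* ((x :- C) :* (x :- C) :+ (y :- C) :* (y :- C) :- (x :- C) :* (y :- C))
    shift-s₁ : ∀ P C x y → P ℚ.* Qf ((ℚ.- x ℚ.+ y) ℚ.- C) (y ℚ.- C)
                           ≡ P ℚ.* Qf (x ℚ.- C) (y ℚ.- C) ℚ.+ (P ℚ.* C) ℚ.* (⟦ + 2 ⟧ ℚ.* x ℚ.- y)
    shift-s₁ = solve 4 (λ P C x y → Xₚ P C (:- x :+ y) y
                                   := Xₚ P C x y :+ (P :* C) :* (con ⟦ + 2 ⟧ :* x :- y)) refl
    shift-s₂ : ∀ P C x y → P ℚ.* Qf (x ℚ.- C) ((ℚ.- y ℚ.+ x) ℚ.- C)
                           ≡ P ℚ.* Qf (x ℚ.- C) (y ℚ.- C) ℚ.+ (P ℚ.* C) ℚ.* (⟦ + 2 ⟧ ℚ.* y ℚ.- x)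
    shift-s₂ = solve 4 (λ P C x y → Xₚ P C x (:- y :+ x)
                                   := Xₚ P C x y :+ (P :* C) :* (con ⟦ + 2 ⟧ :* y :- x)) refl
    shift-s₁s₂ : ∀ P C x y → P ℚ.* Qf ((ℚ.- x ℚ.+ y) ℚ.- C) (ℚ.- x ℚ.- C)
                             ≡ P ℚ.* Qf (x ℚ.- C) (y ℚ.- C) ℚ.+ (P ℚ.* C) ℚ.* (⟦ + 3 ⟧ ℚ.* x)
    shift-s₁s₂ = solve 4 (λ P C x y → Xₚ P C (:- x :+ y) (:- x)
                                     := Xₚ P C x y :+ (P :* C) :* (con ⟦ + 3 ⟧ :* x)) refl
    shift-s₂s₁ : ∀ P C x y → P ℚ.* Qf (ℚ.- y ℚ.- C) ((ℚ.- y ℚ.+ x) ℚ.- C)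
                             ≡ P ℚ.* Qf (x ℚ.- C) (y ℚ.- C) ℚ.+ (P ℚ.* C) ℚ.* (⟦ + 3 ⟧ ℚ.* y)
    shift-s₂s₁ = solve 4 (λ P C x y → Xₚ P C (:- y) (:- y :+ x)
                                     := Xₚ P C x y :+ (P :* C) :* (con ⟦ + 3 ⟧ :* y)) refl
    shift-w₀ : ∀ P C x y → P ℚ.* Qf (ℚ.- y ℚ.- C) (ℚ.- x ℚ.- C)
                           ≡ P ℚ.* Qf (x ℚ.- C) (y ℚ.- C) ℚ.+ (P ℚ.* C) ℚ.* (⟦ + 2 ⟧ ℚ.* x ℚ.+ ⟦ + 2 ⟧ ℚ.* y)
    shift-w₀ = solve 4 (λ P C x y → Xₚ P C (:- y) (:- x)
                                   := Xₚ P C x y :+ (P :* C) :* (con ⟦ + 2 ⟧ :* x :+ con ⟦ + 2 ⟧ :* y)) refl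

  X₀-swap : ∀ a b → X₀ (a , b) ≡ X₀ (b , a)
  X₀-swap a b = swap (+ p) a b
    where
    swap : ∀ P a b → P * (a * a + b * b - a * b) - a - b ≡ P * (b * b + a * a - b * a) - b - a
    swap = solve-∀

  module _ (2≤p : 2 ≤ p) where

    0≤[p-2]Q : ∀ n → 0ℤ ℤ.≤ (+ p - + 2) * Qℤ n
    0≤[p-2]Q n@(a , b) = subst (λ k → 0ℤ ℤ.≤ k * Qℤ n) (sym (ℤP.⊖-≥ 2≤p))
      (subst (ℤ._≤ + (p ℕ.∸ 2) * Qℤ n) (ℤP.*-zeroʳ (+ (p ℕ.∸ 2)))
        (ℤP.*-monoˡ-≤-nonNeg (+ (p ℕ.∸ 2)) (0≤Q a b)))

    a≤1+X₀ : ∀ a b → a ℤ.≤ 1ℤ + X₀ (a , b)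
    a≤1+X₀ a b = ℤP.0≤i-j⇒j≤i (subst (0ℤ ℤ.≤_) (sym (sos (+ p) a b))
      (0≤+ (0≤+ (0≤+ (0≤[p-2]Q (a , b)) (0≤i*i (a - 1ℤ))) (0≤i*i-i b)) (0≤i*i (a - b))))
      where
      sos : ∀ P a b → 1ℤ + (P * (a * a + b * b - a * b) - a - b) - a
                    ≡ (P - + 2) * (a * a + b * b - a * b) + (a - 1ℤ) * (a - 1ℤ) + (b * b - b) + (a - b) * (a - b)
      sos = solve-∀

    -a≤X₀ : ∀ a b → - a ℤ.≤ X₀ (a , b)
    -a≤X₀ a b = ℤP.0≤i-j⇒j≤i (subst (0ℤ ℤ.≤_) (sym (sos (+ p) a b))
      (0≤+ (0≤+ (0≤+ (0≤[p-2]Q (a , b)) (0≤i*i a)) (0≤i*i-i b)) (0≤i*i (a - b))))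
      where
      sos : ∀ P a b → P * (a * a + b * b - a * b) - a - b - - a
                    ≡ (P - + 2) * (a * a + b * b - a * b) + a * a + (b * b - b) + (a - b) * (a - b)
      sos = solve-∀

    ∣a∣≤1+X₀ : ∀ a b → + ∣ a ∣ ℤ.≤ 1ℤ + X₀ (a , b)
    ∣a∣≤1+X₀ (+ n)        b = a≤1+X₀ (+ n) b
    ∣a∣≤1+X₀ a@(-[1+ n ]) b = ℤP.≤-trans (-a≤X₀ a b) (ℤP.i≤j+i _ 1ℤ)

    level-bound : ∀ n → ‖ n ‖ ≤ suc ∣ X₀ n ∣
    level-bound (a , b) =
      ℕP.⊔-lub (coordinate a b) (subst (λ k → ∣ b ∣ ≤ suc ∣ k ∣) (sym (X₀-swap a b)) (coordinate b a))
      where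
      coordinate : ∀ a b → ∣ a ∣ ≤ suc ∣ X₀ (a , b) ∣
      coordinate a b = ℤP.drop‿+≤+ (ℤP.≤-trans (∣a∣≤1+X₀ a b) (ℤP.+-monoʳ-≤ 1ℤ (i≤+∣i∣ (X₀ (a , b)))))

module Coefficient (p : ℕ) .{{_ : NonZero p}} (2≤p : 2 ≤ p) (r₁ r₂ : ℤ) (e : ℚ) where

  open Exponent p
  open ≡-Reasoning

  r : ℤ × ℤ
  r = r₁ , r₂

  δₑ : ℚ → ℤ
  δₑ x = δ ℚP._≟_ x e

  box box⁺ : ℕ → List (ℤ × ℤ)
  box  N = square (symRange N)
  box⁺ N = square (posRange N)

  T : ℕ
  T = suc ∣ ℚ.↥ (e ℚ.- c) ∣

  N₀ : ℕ
  N₀ = T ℕ.+ T ℕ.+ ‖ r ‖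

  N₀≤⇒T≤ : ∀ {N} → N₀ ≤ N → T ≤ N
  N₀≤⇒T≤ N₀≤N = ℕP.≤-trans (ℕP.m≤m+n T T) (ℕP.≤-trans (ℕP.m≤m+n (T ℕ.+ T) ‖ r ‖) N₀≤N)

  on-level⇒bounded : ∀ n → δₑ (X ⟦ n ⟧²) ≢ 0ℤ → ‖ n ‖ ≤ T
  on-level⇒bounded n ne =
    subst (λ k → ‖ n ‖ ≤ suc ∣ k ∣) (X≡⇒X₀≡ (δ≢0⇒≡ ℚP._≟_ ne)) (level-bound 2≤p n)

  F-summand : ℤ × ℤ → ℤ
  F-summand (n₁ , n₂) = δₑ (X ⟦ n₁ , n₂ ⟧²) * summandCoeff r₁ r₂ n₁ n₂

  F-part : W → ℤ × ℤ → ℤ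
  F-part w n = δₑ (X ⟦ n ⟧²) * weight (ℤ².act w n ⊟ r)

  G-part : W → ℤ × ℤ → ℤ
  G-part w m = δₑ (X ⟦ ℤ².act (w ⁻¹) (m ⊞ r) ⟧²) * (proj₁ m ⊓ proj₂ m)

  G-summand : ℤ × ℤ → ℤ
  G-summand m = ∑ (λ w → sign w * G-part w m) elements

  coeffAt-Fbox : ∀ N → coeffAt e (Fbox p r₁ r₂ N) ≡ ∑ F-summand (box N)
  coeffAt-Fbox N = begin
    coeffAt e (Fbox p r₁ r₂ N)
      ≡⟨ coeffAt≡∑ e (Fbox p r₁ r₂ N) ⟩
    ∑ (monomialCoeff e) (concatMap row (symRange N))
      ≡⟨ ∑-concatMap (monomialCoeff e) row (symRange N) ⟩
    ∑ (λ n₁ → ∑ (monomialCoeff e) (row n₁)) (symRange N)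
      ≡⟨ ∑-cong (λ n₁ → ∑-map (monomialCoeff e) (entry n₁) (symRange N)) (symRange N) ⟩
    ∑ (λ n₁ → ∑ (λ n₂ → F-summand (n₁ , n₂)) (symRange N)) (symRange N)
      ≡⟨ ∑-cartesianProduct F-summand (symRange N) (symRange N) ⟨
    ∑ F-summand (box N) ∎
    where
    entry : ℤ → ℤ → ℚ × ℤ
    entry n₁ n₂ = X ⟦ n₁ , n₂ ⟧² , summandCoeff r₁ r₂ n₁ n₂
    row : ℤ → List (ℚ × ℤ)
    row n₁ = map (entry n₁) (symRange N)

  coeffAt-Gbox : ∀ N → coeffAt e (Gbox p ⟦ r₁ ⟧ ⟦ r₂ ⟧ N) ≡ ∑ G-summand (box⁺ N)
  coeffAt-Gbox N = begin
    coeffAt e (Gbox p ⟦ r₁ ⟧ ⟦ r₂ ⟧ N)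
      ≡⟨ coeffAt≡∑ e (Gbox p ⟦ r₁ ⟧ ⟦ r₂ ⟧ N) ⟩
    ∑ (monomialCoeff e) (concatMap (λ m₁ → concatMap (entries m₁) (posRange N)) (posRange N))
      ≡⟨ ∑-concatMap (monomialCoeff e) (λ m₁ → concatMap (entries m₁) (posRange N)) (posRange N) ⟩
    ∑ (λ m₁ → ∑ (monomialCoeff e) (concatMap (entries m₁) (posRange N))) (posRange N)
      ≡⟨ ∑-cong (λ m₁ → ∑-concatMap (monomialCoeff e) (entries m₁) (posRange N)) (posRange N) ⟩
    ∑ (λ m₁ → ∑ (λ m₂ → ∑ (monomialCoeff e) (entries m₁ m₂)) (posRange N)) (posRange N)
      ≡⟨ ∑-cong (λ m₁ → ∑-cong (λ m₂ → entries-coeff (m₁ , m₂)) (posRange N)) (posRange N) ⟩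
    ∑ (λ m₁ → ∑ (λ m₂ → G-summand (m₁ , m₂)) (posRange N)) (posRange N)
      ≡⟨ ∑-cartesianProduct G-summand (posRange N) (posRange N) ⟨
    ∑ G-summand (box⁺ N) ∎
    where
    point : ℤ → ℤ → ℚ × ℚ
    point m₁ m₂ = ⟦ m₁ ⟧ ℚ.+ ⟦ r₁ ⟧ , ⟦ m₂ ⟧ ℚ.+ ⟦ r₂ ⟧
    entry : ℤ → ℤ → W → ℚ × ℤ
    entry m₁ m₂ w = 𝔾-exponent w (point m₁ m₂) , signed w (m₁ ⊓ m₂)
    -- Definitionally, the list that Gbox attaches to (m₁ , m₂).
    entries : ℤ → ℤ → List (ℚ × ℤ)
    entries m₁ m₂ = map (entry m₁ m₂) elements
    exponent : ∀ w m → X ⟦ ℤ².act (w ⁻¹) (m ⊞ r) ⟧² ≡ 𝔾-exponent w (point (proj₁ m) (proj₂ m))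
    exponent w m@(m₁ , m₂) = begin
      X ⟦ ℤ².act (w ⁻¹) (m ⊞ r) ⟧²
        ≡⟨ cong X (act-natural ⟦_⟧ ⟦⟧-homo-+ ⟦⟧-homo‿- (w ⁻¹) (m ⊞ r)) ⟩
      X (ℚ².act (w ⁻¹) ⟦ m ⊞ r ⟧²)
        ≡⟨ cong (X ∘ ℚ².act (w ⁻¹)) (cong₂ _,_ (⟦⟧-homo-+ m₁ r₁) (⟦⟧-homo-+ m₂ r₂)) ⟩
      X (ℚ².act (w ⁻¹) (point m₁ m₂))
        ≡⟨ X-act w (point m₁ m₂) ⟩
      𝔾-exponent w (point m₁ m₂) ∎
    entries-coeff : ∀ m → ∑ (monomialCoeff e) (entries (proj₁ m) (proj₂ m)) ≡ G-summand m
    entries-coeff m@(m₁ , m₂) = trans (∑-map (monomialCoeff e) (entry m₁ m₂) elements) (∑-cong term elements)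
      where
      term : ∀ w → δₑ (𝔾-exponent w (point m₁ m₂)) * signed w (m₁ ⊓ m₂) ≡ sign w * G-part w m
      term w = trans (cong₂ _*_ (cong δₑ (sym (exponent w m))) (signed≡sign* w (m₁ ⊓ m₂)))
                     (x∙yz≈y∙xz (δₑ (X ⟦ ℤ².act (w ⁻¹) (m ⊞ r) ⟧²)) (sign w) (m₁ ⊓ m₂))

  -- summandCoeff r₁ r₂ n₁ n₂ unfolds to the sum over elements in the first line.
  F-summand-decomposition : ∀ n → F-summand n ≡ ∑ (λ w → sign w * F-part w n) elements
  F-summand-decomposition n@(n₁ , n₂) = begin
    δₑ (X ⟦ n ⟧²) * ∑ (λ w → sign w * D w) elements
      ≡⟨ ∑-*ˡ (δₑ (X ⟦ n ⟧²)) (λ w → sign w * D w) elements ⟨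
    ∑ (λ w → δₑ (X ⟦ n ⟧²) * (sign w * D w)) elements
      ≡⟨ ∑-cong (λ w → trans (x∙yz≈y∙xz (δₑ (X ⟦ n ⟧²)) (sign w) (D w))
                             (cong (λ k → sign w * (δₑ (X ⟦ n ⟧²) * k)) (D≡weight w))) elements ⟩
    ∑ (λ w → sign w * F-part w n) elements ∎
    where
    D : W → ℤ
    D w = invDen (proj₁ (ℤ².act w n) - 1ℤ - r₁) (proj₂ (ℤ².act w n) - 1ℤ - r₂)
    reorder : ∀ a r → a - 1ℤ - r ≡ a - r - 1ℤ
    reorder = solve-∀
    D≡weight : ∀ w → D w ≡ weight (ℤ².act w n ⊟ r)
    D≡weight w = cong₂ invDen (reorder (proj₁ (ℤ².act w n)) r₁) (reorder (proj₂ (ℤ².act w n)) r₂)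

  ∑F-summand-stable : ∀ N → T ≤ N → ∑ F-summand (box N) ≡ ∑ F-summand (box T)
  ∑F-summand-stable N T≤N =
    ∑-reindex _≟²_ _≟²_ id id (λ _ → refl) (λ _ → refl)
      (square-unique (symRange-unique N)) (square-unique (symRange-unique T)) F-summand λ n ne →
      let n≤T = on-level⇒bounded n (proj₁ (*≢0 ne)) in
      ∈-square-symRange (ℕP.≤-trans n≤T T≤N) , ∈-square-symRange n≤T

  ∑F-part≡∑G-part : ∀ N → N₀ ≤ N → ∀ w → ∑ (F-part w) (box N) ≡ ∑ (G-part w) (box⁺ N)
  ∑F-part≡∑G-part N N₀≤N w = begin
    ∑ (F-part w) (box N)
      ≡⟨ ∑-reindex _≟²_ _≟²_ φ ψ ψ∘φ φ∘ψ (square-unique (symRange-unique N))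
           (square-unique (posRange-unique N)) (F-part w) support ⟩
    ∑ (F-part w ∘ ψ) (box⁺ N)
      ≡⟨ ∑-cong-∈ (λ {m} m∈ → cong (δₑ (X ⟦ ψ m ⟧²) *_) (weight-φψ m∈)) ⟩
    ∑ (G-part w) (box⁺ N) ∎
    where
    φ ψ : ℤ × ℤ → ℤ × ℤ
    φ n = ℤ².act w n ⊟ r
    ψ m = ℤ².act (w ⁻¹) (m ⊞ r)
    ψ∘φ : ∀ n → ψ (φ n) ≡ n
    ψ∘φ n = trans (cong (ℤ².act (w ⁻¹)) (⊟-⊞-cancel (ℤ².act w n) r)) (act-inverse w n)
    φ∘ψ : ∀ m → φ (ψ m) ≡ m
    φ∘ψ m = trans (cong (_⊟ r) (act-inverseʳ w (m ⊞ r))) (⊞-⊟-cancel m r)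
    ‖φ‖≤N : ∀ n → ‖ n ‖ ≤ T → ‖ φ n ‖ ≤ N
    ‖φ‖≤N n n≤T = ℕP.≤-trans (‖⊟‖≤ (ℤ².act w n) r) (ℕP.≤-trans
      (ℕP.+-monoˡ-≤ ‖ r ‖ (ℕP.≤-trans (act-bound w n) (ℕP.+-mono-≤ n≤T n≤T))) N₀≤N)
    support : ∀ n → F-part w n ≢ 0ℤ → n ∈ box N × φ n ∈ box⁺ N
    support n ne with δ≢0 , weight≢0 ← *≢0 ne =
      let n≤T = on-level⇒bounded n δ≢0
          1≤φ₁ , 1≤φ₂ = weight-support (φ n) weight≢0
          ‖φ‖≤ = ‖φ‖≤N n n≤T in
      ∈-square-symRange (ℕP.≤-trans n≤T (N₀≤⇒T≤ N₀≤N)) ,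
      ∈-cartesianProduct⁺ (∈-posRange 1≤φ₁ (ℕP.m⊔n≤o⇒m≤o _ _ ‖φ‖≤)) (∈-posRange 1≤φ₂ (ℕP.m⊔n≤o⇒n≤o _ _ ‖φ‖≤))
    weight-φψ : ∀ {m} → m ∈ box⁺ N → weight (φ (ψ m)) ≡ proj₁ m ⊓ proj₂ m
    weight-φψ {m} m∈ with m₁∈ , m₂∈ ← ∈-cartesianProduct⁻ (posRange N) (posRange N) m∈ =
      trans (cong weight (φ∘ψ m)) (weight-positive (∈-posRange⁻ m₁∈) (∈-posRange⁻ m₂∈))

  coeffAt-Gbox≡∑F-summand : ∀ N → N₀ ≤ N → coeffAt e (Gbox p ⟦ r₁ ⟧ ⟦ r₂ ⟧ N) ≡ ∑ F-summand (box N)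
  coeffAt-Gbox≡∑F-summand N N₀≤N = begin
    coeffAt e (Gbox p ⟦ r₁ ⟧ ⟦ r₂ ⟧ N)
      ≡⟨ coeffAt-Gbox N ⟩
    ∑ (λ m → ∑ (λ w → sign w * G-part w m) elements) (box⁺ N)
      ≡⟨ ∑-comm-*ˡ sign G-part (box⁺ N) elements ⟩
    ∑ (λ w → sign w * ∑ (G-part w) (box⁺ N)) elements
      ≡⟨ ∑-cong (λ w → cong (sign w *_) (∑F-part≡∑G-part N N₀≤N w)) elements ⟨
    ∑ (λ w → sign w * ∑ (F-part w) (box N)) elements
      ≡⟨ ∑-comm-*ˡ sign F-part (box N) elements ⟨
    ∑ (λ n → ∑ (λ w → sign w * F-part w n) elements) (box N)
      ≡⟨ ∑-cong F-summand-decomposition (box N) ⟨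
    ∑ F-summand (box N) ∎

proposition3p2 : (p : ℕ) → 2 ≤ p → .{{_ : NonZero p}} → (r₁ r₂ : ℤ) → (e : ℚ) →
    ∃[ B ] ∃[ c ] ((N : ℕ) → B ≤ N →
      (coeffAt e (Fbox p r₁ r₂ N) ≡ c) × (coeffAt e (Gbox p ⟦ r₁ ⟧ ⟦ r₂ ⟧ N) ≡ c))
proposition3p2 p 2≤p r₁ r₂ e = N₀ , ∑ F-summand (box T) , λ N N₀≤N →
    trans (coeffAt-Fbox N) (∑F-summand-stable N (N₀≤⇒T≤ N₀≤N)) ,
    trans (coeffAt-Gbox≡∑F-summand N N₀≤N) (∑F-summand-stable N (N₀≤⇒T≤ N₀≤N))
  where
  open Coefficient p 2≤p r₁ r₂ e
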